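{- Let $M$ be a nonstandard model of $IE_2$ and let $H\subseteq M$ be a subgroup with $(M,+)=H\oplus\mathbb{Z}$. Then for every $m\in M$ there is $z\in\mathbb{Z}$ such that $m\equiv z \pmod p$ for all standard primes $p$.
   Context: $E_2$ is the class of formulas in the language $\{0,1,+,\cdot,<\}$ of the form $\exists x<t_1\,\forall y<t_2\,\phi(x,y,\vec z)$ with $t_1$ a term not containing $x$, $t_2$ a term not containing $y$, and $\phi$ open. $IE_2$ is the basic axioms of arithmetic plus induction for $E_2$-formulas. $M$ is identified with the discretely ordered ring of which it is the nonnegative part; $(M,+)$ is its additive group, $\mathbb{Z}$ the subgroup of standard integers, and $\oplus$ internal direct sum. $m\equiv z\pmod p$ means $p$ divides $m-z$ in $M$. -}

module Defs where

open import Data.Nat using (ℕ; zero; suc)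
open import Data.Integer using (ℤ; +_; -[1+_])
open import Data.Fin using (Fin)
open import Data.Vec using (Vec; _∷_; lookup)
open import Data.Product using (Σ; _×_; _,_)
open import Data.Sum using (_⊎_)
open import Relation.Nullary using (¬_)
open import Relation.Binary.PropositionalEquality using (_≡_)

-- Structures for the language {0,1,+,·,<}; equality is true equality.

record Structure : Set₁ where
  field
    Carrier : Set
    𝟘 𝟙     : Carrier
    _⊕_ _⊗_ : Carrier → Carrier → Carrier
    _≺_     : Carrier → Carrier → Set

data Term (n : ℕ) : Set where
  var  : Fin n → Term n
  zer  : Term n
  one  : Term n
  _+ᵗ_ : Term n → Term n → Term n
  _*ᵗ_ : Term n → Term n → Term n

data Open (n : ℕ) : Set where
  _=ᶠ_ : Term n → Term n → Open n
  _<ᶠ_ : Term n → Term n → Open n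
  ¬ᶠ_  : Open n → Open n
  _∧ᶠ_ : Open n → Open n → Open n
  _∨ᶠ_ : Open n → Open n → Open n

-- ∃ x < t₁ ∀ y < t₂ φ(x,y,z⃗):
--   t₁ : Term n         (only z⃗; does not contain x)
--   t₂ : Term (suc n)   (variable 0 is x, the rest z⃗; does not contain y)
--   φ  : Open (2 + n)   (variable 0 is y, variable 1 is x, the rest z⃗)
record E₂ (n : ℕ) : Set where
  constructor ∃<∀<
  field
    t₁ : Term n
    t₂ : Term (suc n)
    φ  : Open (suc (suc n))

module Semantics (S : Structure) where
  open Structure S

  ⟦_⟧ᵗ : ∀ {n} → Term n → Vec Carrier n → Carrier
  ⟦ var i ⟧ᵗ ρ   = lookup ρ i
  ⟦ zer ⟧ᵗ ρ     = 𝟘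
  ⟦ one ⟧ᵗ ρ     = 𝟙
  ⟦ s +ᵗ t ⟧ᵗ ρ  = ⟦ s ⟧ᵗ ρ ⊕ ⟦ t ⟧ᵗ ρ
  ⟦ s *ᵗ t ⟧ᵗ ρ  = ⟦ s ⟧ᵗ ρ ⊗ ⟦ t ⟧ᵗ ρ

  ⟦_⟧ᵒ : ∀ {n} → Open n → Vec Carrier n → Set
  ⟦ s =ᶠ t ⟧ᵒ ρ = ⟦ s ⟧ᵗ ρ ≡ ⟦ t ⟧ᵗ ρ
  ⟦ s <ᶠ t ⟧ᵒ ρ = ⟦ s ⟧ᵗ ρ ≺ ⟦ t ⟧ᵗ ρ
  ⟦ ¬ᶠ φ ⟧ᵒ ρ   = ¬ ⟦ φ ⟧ᵒ ρ
  ⟦ φ ∧ᶠ ψ ⟧ᵒ ρ = ⟦ φ ⟧ᵒ ρ × ⟦ ψ ⟧ᵒ ρ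
  ⟦ φ ∨ᶠ ψ ⟧ᵒ ρ = ⟦ φ ⟧ᵒ ρ ⊎ ⟦ ψ ⟧ᵒ ρ

  ⟦_⟧ᴱ : ∀ {n} → E₂ n → Vec Carrier n → Set
  ⟦ ∃<∀< t₁ t₂ φ ⟧ᴱ ρ =
    Σ Carrier λ x → (x ≺ ⟦ t₁ ⟧ᵗ ρ) ×
      ((y : Carrier) → y ≺ ⟦ t₂ ⟧ᵗ (x ∷ ρ) → ⟦ φ ⟧ᵒ (y ∷ x ∷ ρ))

  num : ℕ → Carrier
  num zero    = 𝟘
  num (suc k) = num k ⊕ 𝟙

record IsIE₂ (S : Structure) : Set where
  open Structure S
  open Semantics S
  field
    +-comm   : ∀ x y → x ⊕ y ≡ y ⊕ x
    +-assoc  : ∀ x y z → (x ⊕ y) ⊕ z ≡ x ⊕ (y ⊕ z)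
    *-comm   : ∀ x y → x ⊗ y ≡ y ⊗ x
    *-assoc  : ∀ x y z → (x ⊗ y) ⊗ z ≡ x ⊗ (y ⊗ z)
    distrib  : ∀ x y z → x ⊗ (y ⊕ z) ≡ (x ⊗ y) ⊕ (x ⊗ z)
    +-zero   : ∀ x → x ⊕ 𝟘 ≡ x
    *-zero   : ∀ x → x ⊗ 𝟘 ≡ 𝟘
    *-one    : ∀ x → x ⊗ 𝟙 ≡ x
    <-trans  : ∀ x y z → x ≺ y → y ≺ z → x ≺ z
    <-irrefl : ∀ x → ¬ (x ≺ x)
    <-trich  : ∀ x y → (x ≺ y) ⊎ (x ≡ y) ⊎ (y ≺ x)
    +-mono   : ∀ x y z → x ≺ y → (x ⊕ z) ≺ (y ⊕ z)
    *-mono   : ∀ x y z → 𝟘 ≺ z → x ≺ y → (x ⊗ z) ≺ (y ⊗ z)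
    sub      : ∀ x y → x ≺ y → Σ Carrier λ z → x ⊕ z ≡ y
    0<1      : 𝟘 ≺ 𝟙
    discrete : ∀ x → 𝟘 ≺ x → (𝟙 ≡ x) ⊎ (𝟙 ≺ x)
    nonneg   : ∀ x → (𝟘 ≡ x) ⊎ (𝟘 ≺ x)
    ind : ∀ {n} (φ : E₂ (suc n)) (ρ : Vec Carrier n) →
          ⟦ φ ⟧ᴱ (𝟘 ∷ ρ) →
          ((x : Carrier) → ⟦ φ ⟧ᴱ (x ∷ ρ) → ⟦ φ ⟧ᴱ ((x ⊕ 𝟙) ∷ ρ)) →
          (x : Carrier) → ⟦ φ ⟧ᴱ (x ∷ ρ)

record ModelIE₂ : Set₁ where
  field
    str  : Structure
    isIE₂ : IsIE₂ str
  open Structure str public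
  open Semantics str public

-- The discretely ordered ring of which M is the nonnegative part,
-- realised as formal differences (a , b) ↦ a − b.

module RingOf (M : ModelIE₂) where
  open ModelIE₂ M public

  R : Set
  R = Carrier × Carrier

  _≈_ : R → R → Set
  (a , b) ≈ (c , d) = a ⊕ d ≡ c ⊕ b

  0R : R
  0R = 𝟘 , 𝟘

  _+R_ : R → R → R
  (a , b) +R (c , d) = (a ⊕ c) , (b ⊕ d)

  -R_ : R → R
  -R (a , b) = b , a

  _-R_ : R → R → R
  x -R y = x +R (-R y)

  _*R_ : R → R → R
  (a , b) *R (c , d) = ((a ⊗ c) ⊕ (b ⊗ d)) , ((a ⊗ d) ⊕ (b ⊗ c))

  ι : Carrier → R
  ι m = m , 𝟘

  ⌜_⌝ : ℤ → R
  ⌜ + k ⌝      = num k , 𝟘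
  ⌜ -[1+ k ] ⌝ = 𝟘 , num (suc k)

  record IsSubgroup (H : R → Set) : Set where
    field
      resp  : ∀ {x y} → x ≈ y → H x → H y
      has-0 : H 0R
      +-cl  : ∀ {x y} → H x → H y → H (x +R y)
      neg-cl : ∀ {x} → H x → H (-R x)

  record IsDirectSumWithℤ (H : R → Set) : Set where
    field
      span     : ∀ g → Σ R λ h → Σ ℤ λ z → H h × (g ≈ (h +R ⌜ z ⌝))
      disjoint : ∀ z → H ⌜ z ⌝ → z ≡ + 0

  _∣R_ : R → R → Set
  d ∣R x = Σ R λ q → x ≈ (d *R q)

  Nonstandard : Set
  Nonstandard = Σ Carrier λ c → ∀ k → num k ≺ c

module Submission where

-- Write ι m = h + z with h ∈ H and z ∈ ℤ; it suffices that every h ∈ H is divisible by every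
-- standard p > 0. Induction on the E₂-formula ∃ q < x + 1 ⋁_{r < p} x = p·q + r gives division
-- with remainder in M, so h = p·q + r with r a standard integer. Splitting q = h′ + z′ with h′ ∈ H,
-- the element h − p·h′ = p·z′ + r is a standard integer lying in H, hence 0, i.e. h = p·h′.

open import Defs
open import Data.Nat using (ℕ)
open import Data.Integer using (ℤ; +_)
open import Data.Nat.Primality using (Prime; prime⇒nonZero)
open import Data.Product using (Σ)

open import Data.Nat as ℕ using (zero; suc; _≤_; z≤n; s≤s; NonZero)
import Data.Nat.Properties as ℕ
open import Data.Integer using (-[1+_])
open import Data.Product using (_×_; _,_)
open import Data.Sum using (inj₁; inj₂)
import Data.Fin as Fin
open import Data.Vec using (Vec; []; _∷_)
open import Data.Empty using (⊥-elim)
open import Relation.Binary.PropositionalEquality using (_≡_; refl; sym; trans; cong; cong₂; subst; subst₂; isEquivalence; module ≡-Reasoning)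
open import Algebra using (CommutativeSemiring; CommutativeRing)
open import Algebra.Structures using (IsCommutativeSemiring; IsCommutativeRing)
open import Relation.Binary.Structures using (IsEquivalence)
open import Algebra.Structures.Biased using (isCommutativeSemiringʳ)

module _ (M : ModelIE₂) where
  open RingOf M
  open IsIE₂ isIE₂

  isCommutativeSemiring : IsCommutativeSemiring {A = Carrier} _≡_ _⊕_ _⊗_ 𝟘 𝟙
  isCommutativeSemiring = isCommutativeSemiringʳ record
    { +-isCommutativeMonoid = record
      { isMonoid = record
        { isSemigroup = record
          { isMagma = record { isEquivalence = isEquivalence ; ∙-cong = cong₂ _⊕_ }
          ; assoc = +-assoc }
        ; identity = (λ x → trans (+-comm 𝟘 x) (+-zero x)) , +-zero }
      ; comm = +-comm }
    ; *-isCommutativeMonoid = record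
      { isMonoid = record
        { isSemigroup = record
          { isMagma = record { isEquivalence = isEquivalence ; ∙-cong = cong₂ _⊗_ }
          ; assoc = *-assoc }
        ; identity = (λ x → trans (*-comm 𝟙 x) (*-one x)) , *-one }
      ; comm = *-comm }
    ; distribˡ = distrib
    ; zeroʳ = *-zero }

  commutativeSemiring : CommutativeSemiring _ _
  commutativeSemiring = record { isCommutativeSemiring = isCommutativeSemiring }

  module Semiring = CommutativeSemiring commutativeSemiring

  open import Algebra.Solver.Ring.NaturalCoefficients.Default commutativeSemiring
    using (solve; _:=_; _:+_; _:*_; con)

  +-cancelʳ : ∀ x y z → x ⊕ z ≡ y ⊕ z → x ≡ y
  +-cancelʳ x y z e with <-trich x y
  ... | inj₁ x<y        = ⊥-elim (<-irrefl _ (subst (_≺ (y ⊕ z)) e (+-mono x y z x<y)))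
  ... | inj₂ (inj₁ x≡y) = x≡y
  ... | inj₂ (inj₂ y<x) = ⊥-elim (<-irrefl _ (subst ((y ⊕ z) ≺_) e (+-mono y x z y<x)))

  x≺x⊕𝟙 : ∀ x → x ≺ (x ⊕ 𝟙)
  x≺x⊕𝟙 x = subst₂ _≺_ (Semiring.+-identityˡ x) (+-comm 𝟙 x) (+-mono 𝟘 𝟙 x 0<1)

  num-+ : ∀ m n → num (m ℕ.+ n) ≡ num m ⊕ num n
  num-+ zero    n = solve 1 (λ y → y := con 0 :+ y) refl (num n)
  num-+ (suc m) n = trans (cong (_⊕ 𝟙) (num-+ m n))
    (solve 2 (λ x y → (x :+ y) :+ con 1 := (x :+ con 1) :+ y) refl (num m) (num n))

  num-* : ∀ m n → num (m ℕ.* n) ≡ num m ⊗ num n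
  num-* zero    n = solve 1 (λ y → con 0 := con 0 :* y) refl (num n)
  num-* (suc m) n = trans (num-+ n (m ℕ.* n)) (trans (cong (num n ⊕_) (num-* m n))
    (solve 2 (λ x y → y :+ x :* y := (x :+ con 1) :* y) refl (num m) (num n)))

  numᵗ : ∀ {n} → ℕ → Term n
  numᵗ zero    = zer
  numᵗ (suc k) = numᵗ k +ᵗ one

  ⟦numᵗ⟧ : ∀ {n} k (ρ : Vec Carrier n) → ⟦ numᵗ k ⟧ᵗ ρ ≡ num k
  ⟦numᵗ⟧ zero    ρ = refl
  ⟦numᵗ⟧ (suc k) ρ = cong (_⊕ 𝟙) (⟦numᵗ⟧ k ρ)

  HasRemainder≤ : ℕ → ℕ → Carrier → Carrier → Set
  HasRemainder≤ k j x q = Σ ℕ λ r → r ≤ j × x ≡ (num (suc k) ⊗ q) ⊕ num r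

  -- In the environment y ∷ q ∷ x ∷ [], the open formula x = (k+1)·q + r.
  remainderIs : ℕ → ℕ → Open 3
  remainderIs k r =
    var (Fin.suc (Fin.suc Fin.zero)) =ᶠ ((numᵗ (suc k) *ᵗ var (Fin.suc Fin.zero)) +ᵗ numᵗ r)

  remainder≤ : ℕ → ℕ → Open 3
  remainder≤ k zero    = remainderIs k zero
  remainder≤ k (suc j) = remainder≤ k j ∨ᶠ remainderIs k (suc j)

  ⟦remainderIs⟧ : ∀ k r y q x →
    ⟦ remainderIs k r ⟧ᵒ (y ∷ q ∷ x ∷ []) ≡ (x ≡ (num (suc k) ⊗ q) ⊕ num r)
  ⟦remainderIs⟧ k r y q x =
    cong₂ (λ p s → x ≡ (p ⊗ q) ⊕ s) (⟦numᵗ⟧ (suc k) (y ∷ q ∷ x ∷ [])) (⟦numᵗ⟧ r (y ∷ q ∷ x ∷ []))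

  remainder≤-sound : ∀ k j y q x → ⟦ remainder≤ k j ⟧ᵒ (y ∷ q ∷ x ∷ []) → HasRemainder≤ k j x q
  remainder≤-sound k zero    y q x φ        = zero , z≤n , subst (λ A → A) (⟦remainderIs⟧ k zero y q x) φ
  remainder≤-sound k (suc j) y q x (inj₁ φ) with remainder≤-sound k j y q x φ
  ... | r , r≤j , e = r , ℕ.m≤n⇒m≤1+n r≤j , e
  remainder≤-sound k (suc j) y q x (inj₂ φ) = suc j , ℕ.≤-refl , subst (λ A → A) (⟦remainderIs⟧ k (suc j) y q x) φ

  remainder≤-complete : ∀ k j y q x → HasRemainder≤ k j x q → ⟦ remainder≤ k j ⟧ᵒ (y ∷ q ∷ x ∷ [])
  remainder≤-complete k zero    y q x (zero , _ , e) = subst (λ A → A) (sym (⟦remainderIs⟧ k zero y q x)) e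
  remainder≤-complete k (suc j) y q x (r , r≤1+j , e) with ℕ.m≤n⇒m<n∨m≡n r≤1+j
  ... | inj₁ (s≤s r≤j) = inj₁ (remainder≤-complete k j y q x (r , r≤j , e))
  ... | inj₂ refl      = inj₂ (subst (λ A → A) (sym (⟦remainderIs⟧ k (suc j) y q x)) e)

  -- ∃ q < x + 1 ∀ y < 1 (x = (k+1)·q + r for some r ≤ k); the universal quantifier is vacuous.
  divisionBy : ℕ → E₂ 1
  divisionBy k = ∃<∀< (var Fin.zero +ᵗ one) one (remainder≤ k k)

  divisionBy-zero : ∀ k → ⟦ divisionBy k ⟧ᴱ (𝟘 ∷ [])
  divisionBy-zero k = 𝟘 , subst (𝟘 ≺_) (sym (Semiring.+-identityˡ 𝟙)) 0<1 ,
    λ y _ → remainder≤-complete k k y 𝟘 𝟘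
      (zero , z≤n , solve 1 (λ p → con 0 := (p :+ con 1) :* con 0 :+ con 0) refl (num k))

  divisionBy-suc : ∀ k x → ⟦ divisionBy k ⟧ᴱ (x ∷ []) → ⟦ divisionBy k ⟧ᴱ ((x ⊕ 𝟙) ∷ [])
  divisionBy-suc k x (q , q<x+1 , φ) with remainder≤-sound k k 𝟘 q x (φ 𝟘 0<1)
  ... | r , r≤k , e with ℕ.m≤n⇒m<n∨m≡n r≤k
  ...   | inj₁ r<k  = q , <-trans _ _ _ q<x+1 (x≺x⊕𝟙 (x ⊕ 𝟙)) ,
          λ y _ → remainder≤-complete k k y q (x ⊕ 𝟙)
            (suc r , r<k , trans (cong (_⊕ 𝟙) e) (+-assoc _ (num r) 𝟙))
  ...   | inj₂ refl = q ⊕ 𝟙 , +-mono q (x ⊕ 𝟙) 𝟙 q<x+1 ,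
          λ y _ → remainder≤-complete k k y (q ⊕ 𝟙) (x ⊕ 𝟙)
            (zero , z≤n , trans (cong (_⊕ 𝟙) e)
              (solve 2 (λ p q → ((p :+ con 1) :* q :+ p) :+ con 1 := (p :+ con 1) :* (q :+ con 1) :+ con 0)
                refl (num r) q))

  divMod : ∀ k x → Σ Carrier λ q → HasRemainder≤ k k x q
  divMod k x with ind (divisionBy k) [] (divisionBy-zero k) (divisionBy-suc k) x
  ... | q , _ , φ = q , remainder≤-sound k k 𝟘 q x (φ 𝟘 0<1)

  ≈-trans : ∀ {x y z} → x ≈ y → y ≈ z → x ≈ z
  ≈-trans {a , b} {c , d} {e , f} x≈y y≈z = +-cancelʳ (a ⊕ f) (e ⊕ b) d (begin
    (a ⊕ f) ⊕ d  ≡⟨ solve 3 (λ a f d → (a :+ f) :+ d := (a :+ d) :+ f) refl a f d ⟩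
    (a ⊕ d) ⊕ f  ≡⟨ cong (_⊕ f) x≈y ⟩
    (c ⊕ b) ⊕ f  ≡⟨ solve 3 (λ c b f → (c :+ b) :+ f := (c :+ f) :+ b) refl c b f ⟩
    (c ⊕ f) ⊕ b  ≡⟨ cong (_⊕ b) y≈z ⟩
    (e ⊕ d) ⊕ b  ≡⟨ solve 3 (λ e d b → (e :+ d) :+ b := (e :+ b) :+ d) refl e d b ⟩
    (e ⊕ b) ⊕ d  ∎)
    where open ≡-Reasoning

  ≈-isEquivalence : IsEquivalence _≈_
  ≈-isEquivalence = record
    { refl  = refl
    ; sym   = λ {x} {y} → sym
    ; trans = λ {x} {y} {z} → ≈-trans {x} {y} {z} }

  1R : R
  1R = ι 𝟙

  +R-cong : ∀ {x y u v} → x ≈ y → u ≈ v → (x +R u) ≈ (y +R v)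
  +R-cong {a , b} {a′ , b′} {c , d} {c′ , d′} x≈y u≈v = begin
    (a ⊕ c) ⊕ (b′ ⊕ d′)  ≡⟨ solve 4 (λ a c b′ d′ → (a :+ c) :+ (b′ :+ d′) := (a :+ b′) :+ (c :+ d′)) refl a c b′ d′ ⟩
    (a ⊕ b′) ⊕ (c ⊕ d′)  ≡⟨ cong₂ _⊕_ x≈y u≈v ⟩
    (a′ ⊕ b) ⊕ (c′ ⊕ d)  ≡⟨ solve 4 (λ a′ b c′ d → (a′ :+ b) :+ (c′ :+ d) := (a′ :+ c′) :+ (b :+ d)) refl a′ b c′ d ⟩
    (a′ ⊕ c′) ⊕ (b ⊕ d)  ∎
    where open ≡-Reasoning

  -R-cong : ∀ {x y} → x ≈ y → (-R x) ≈ (-R y)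
  -R-cong {a , b} {c , d} x≈y = trans (+-comm b c) (trans (sym x≈y) (+-comm a d))

  *R-congˡ : ∀ x {u v} → u ≈ v → (x *R u) ≈ (x *R v)
  *R-congˡ (a , b) {c , d} {c′ , d′} u≈v = begin
    ((a ⊗ c) ⊕ (b ⊗ d)) ⊕ ((a ⊗ d′) ⊕ (b ⊗ c′))
      ≡⟨ solve 6 (λ a b c d c′ d′ → ((a :* c) :+ (b :* d)) :+ ((a :* d′) :+ (b :* c′))
                                 := (a :* (c :+ d′)) :+ (b :* (c′ :+ d))) refl a b c d c′ d′ ⟩
    (a ⊗ (c ⊕ d′)) ⊕ (b ⊗ (c′ ⊕ d))
      ≡⟨ cong₂ (λ s t → (a ⊗ s) ⊕ (b ⊗ t)) u≈v (sym u≈v) ⟩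
    (a ⊗ (c′ ⊕ d)) ⊕ (b ⊗ (c ⊕ d′))
      ≡⟨ solve 6 (λ a b c d c′ d′ → (a :* (c′ :+ d)) :+ (b :* (c :+ d′))
                                 := ((a :* c′) :+ (b :* d′)) :+ ((a :* d) :+ (b :* c))) refl a b c d c′ d′ ⟩
    ((a ⊗ c′) ⊕ (b ⊗ d′)) ⊕ ((a ⊗ d) ⊕ (b ⊗ c))  ∎
    where open ≡-Reasoning

  *R-comm : ∀ x y → (x *R y) ≈ (y *R x)
  *R-comm (a , b) (c , d) =
    solve 4 (λ a b c d → ((a :* c) :+ (b :* d)) :+ ((c :* b) :+ (d :* a))
                      := ((c :* a) :+ (d :* b)) :+ ((a :* d) :+ (b :* c))) refl a b c d

  *R-cong : ∀ {x y u v} → x ≈ y → u ≈ v → (x *R u) ≈ (y *R v)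
  *R-cong {x} {y} {u} {v} x≈y u≈v =
    ≈-trans {x *R u} {x *R v} (*R-congˡ x u≈v)
      (≈-trans {x *R v} {v *R x} (*R-comm x v)
        (≈-trans {v *R x} {v *R y} (*R-congˡ v x≈y) (*R-comm v y)))

  isCommutativeRing : IsCommutativeRing _≈_ _+R_ _*R_ -R_ 0R 1R
  isCommutativeRing = record
    { isRing = record
      { +-isAbelianGroup = record
        { isGroup = record
          { isMonoid = record
            { isSemigroup = record
              { isMagma = record { isEquivalence = ≈-isEquivalence ; ∙-cong = +R-cong }
              ; assoc   = λ { (a , b) (c , d) (e , f) →
                  solve 6 (λ a b c d e f → ((a :+ c) :+ e) :+ (b :+ (d :+ f))
                                        := (a :+ (c :+ e)) :+ ((b :+ d) :+ f)) refl a b c d e f } }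
            ; identity =
                (λ { (a , b) → solve 2 (λ a b → (con 0 :+ a) :+ b := a :+ (con 0 :+ b)) refl a b }) ,
                (λ { (a , b) → solve 2 (λ a b → (a :+ con 0) :+ b := a :+ (b :+ con 0)) refl a b }) }
          ; inverse =
              (λ { (a , b) → solve 2 (λ a b → (b :+ a) :+ con 0 := con 0 :+ (a :+ b)) refl a b }) ,
              (λ { (a , b) → solve 2 (λ a b → (a :+ b) :+ con 0 := con 0 :+ (b :+ a)) refl a b })
          ; ⁻¹-cong = -R-cong }
        ; comm = λ { (a , b) (c , d) →
            solve 4 (λ a b c d → (a :+ c) :+ (d :+ b) := (c :+ a) :+ (b :+ d)) refl a b c d } }
      ; *-cong   = *R-cong
      ; *-assoc  = λ { (a , b) (c , d) (e , f) →
          solve 6 (λ a b c d e f →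
              (((a :* c :+ b :* d) :* e) :+ ((a :* d :+ b :* c) :* f))
                :+ ((a :* (c :* f :+ d :* e)) :+ (b :* (c :* e :+ d :* f)))
           := ((a :* (c :* e :+ d :* f)) :+ (b :* (c :* f :+ d :* e)))
                :+ (((a :* c :+ b :* d) :* f) :+ ((a :* d :+ b :* c) :* e))) refl a b c d e f }
      ; *-identity =
          (λ { (a , b) → solve 2 (λ a b → (con 1 :* a :+ con 0 :* b) :+ b
                                       := a :+ (con 1 :* b :+ con 0 :* a)) refl a b }) ,
          (λ { (a , b) → solve 2 (λ a b → (a :* con 1 :+ b :* con 0) :+ b
                                       := a :+ (a :* con 0 :+ b :* con 1)) refl a b })
      ; distrib  =
          (λ { (a , b) (c , d) (e , f) →
            solve 6 (λ a b c d e f →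
                (a :* (c :+ e) :+ b :* (d :+ f)) :+ ((a :* d :+ b :* c) :+ (a :* f :+ b :* e))
             := ((a :* c :+ b :* d) :+ (a :* e :+ b :* f)) :+ (a :* (d :+ f) :+ b :* (c :+ e))) refl a b c d e f }) ,
          (λ { (a , b) (c , d) (e , f) →
            solve 6 (λ a b c d e f →
                ((c :+ e) :* a :+ (d :+ f) :* b) :+ ((c :* b :+ d :* a) :+ (e :* b :+ f :* a))
             := ((c :* a :+ d :* b) :+ (e :* a :+ f :* b)) :+ ((c :+ e) :* b :+ (d :+ f) :* a)) refl a b c d e f }) }
    ; *-comm = *R-comm }

  ring : CommutativeRing _ _
  ring = record { isCommutativeRing = isCommutativeRing }

  module Ring = CommutativeRing ring

  num-affine : ∀ p m r → num (p ℕ.* m ℕ.+ r) ≡ (num p ⊗ num m) ⊕ num r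
  num-affine p m r = trans (num-+ (p ℕ.* m) r) (cong (_⊕ num r) (num-* p m))

  ι-affine-pair : ∀ p a b q₁ q₂ r₁ r₂ → a ≡ (p ⊗ q₁) ⊕ r₁ → b ≡ (p ⊗ q₂) ⊕ r₂ →
    (a , b) ≈ ((ι p *R (q₁ , q₂)) +R (r₁ , r₂))
  ι-affine-pair p a b q₁ q₂ r₁ r₂ refl refl =
    solve 5 (λ p q₁ q₂ r₁ r₂ →
        (p :* q₁ :+ r₁) :+ ((p :* q₂ :+ con 0 :* q₁) :+ r₂)
     := ((p :* q₁ :+ con 0 :* q₂) :+ r₁) :+ (p :* q₂ :+ r₂)) refl p q₁ q₂ r₁ r₂

  ⌜⌝-as-pair : ∀ z → Σ ℕ λ m → Σ ℕ λ n → ⌜ z ⌝ ≈ (num m , num n)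
  ⌜⌝-as-pair (+ k)    = k , 0 , refl
  ⌜⌝-as-pair -[1+ k ] = 0 , suc k , refl

  open import Algebra.Properties.AbelianGroup Ring.+-abelianGroup using (xyx⁻¹≈y)
  open import Algebra.Properties.Group Ring.+-group using (x∙y⁻¹≈ε⇒x≈y)

  x≈y+z⇒x-y≈z : ∀ {x y z} → x ≈ (y +R z) → (x -R y) ≈ z
  x≈y+z⇒x-y≈z {x} {y} {z} x≈y+z = Ring.trans (Ring.+-cong x≈y+z Ring.refl) (xyx⁻¹≈y y z)

  module _ (H : R → Set) (H-subgroup : IsSubgroup H) (H⊕ℤ : IsDirectSumWithℤ H) where
    open IsSubgroup H-subgroup
    open IsDirectSumWithℤ H⊕ℤ

    ⌜+n⌝*-closed : ∀ n {x} → H x → H (⌜ + n ⌝ *R x)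
    ⌜+n⌝*-closed zero    {x} x∈H = resp (Ring.sym (Ring.zeroˡ x)) has-0
    ⌜+n⌝*-closed (suc n) {x} x∈H = resp n*x+x≈[n+1]*x (+-cl (⌜+n⌝*-closed n x∈H) x∈H)
      where
      open import Relation.Binary.Reasoning.Setoid Ring.setoid
      n*x+x≈[n+1]*x : ((⌜ + n ⌝ *R x) +R x) ≈ (⌜ + suc n ⌝ *R x)
      n*x+x≈[n+1]*x = begin
        (⌜ + n ⌝ *R x) +R x           ≈⟨ Ring.+-cong Ring.refl (Ring.sym (Ring.*-identityˡ x)) ⟩
        (⌜ + n ⌝ *R x) +R (1R *R x)   ≈⟨ Ring.sym (Ring.distribʳ x ⌜ + n ⌝ 1R) ⟩
        (⌜ + n ⌝ +R 1R) *R x          ≈⟨ Ring.*-cong (cong ((num n ⊕ 𝟙) ⊕_) (sym (+-zero 𝟘))) Ring.refl ⟩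
        ⌜ + suc n ⌝ *R x              ∎

    num-difference∈H-≤ : ∀ {m n} → n ≤ m → H (num m , num n) → m ≡ n
    num-difference∈H-≤ {m} {n} n≤m m-n∈H with ℕ.m≤n⇒∃[o]m+o≡n n≤m
    ... | d , n+d≡m with disjoint (+ d) (resp m-n≈d m-n∈H)
      where
      m-n≈d : (num m , num n) ≈ ⌜ + d ⌝
      m-n≈d = trans (+-zero (num m)) (trans (cong num (sym n+d≡m)) (trans (num-+ n d) (+-comm (num n) (num d))))
    ... | refl = trans (sym n+d≡m) (ℕ.+-identityʳ n)

    num-difference∈H⇒≡ : ∀ m n → H (num m , num n) → m ≡ n
    num-difference∈H⇒≡ m n m-n∈H with ℕ.≤-total n m
    ... | inj₁ n≤m = num-difference∈H-≤ n≤m m-n∈H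
    ... | inj₂ m≤n = sym (num-difference∈H-≤ m≤n (neg-cl m-n∈H))

    H-divisible : ∀ p .{{_ : NonZero p}} {h} → H h → ⌜ + p ⌝ ∣R h
    H-divisible (suc k) {a , b} h∈H with divMod k a | divMod k b
    ... | q₁ , r₁ , _ , a≡pq₁+r₁ | q₂ , r₂ , _ , b≡pq₂+r₂ with span (q₁ , q₂)
    ... | h′ , z , h′∈H , q≈h′+z with ⌜⌝-as-pair z
    ... | m , n , z≈m-n = h′ , x∙y⁻¹≈ε⇒x≈y (a , b) (p *R h′) h-ph′≈0
      where
      open import Relation.Binary.Reasoning.Setoid Ring.setoid
      p = ⌜ + suc k ⌝
      r = (num r₁ , num r₂)
      h-ph′≈pz+r : ((a , b) -R (p *R h′)) ≈ ((p *R (num m , num n)) +R r)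
      h-ph′≈pz+r = x≈y+z⇒x-y≈z (begin
        (a , b)                               ≈⟨ ι-affine-pair (num (suc k)) a b q₁ q₂ (num r₁) (num r₂) a≡pq₁+r₁ b≡pq₂+r₂ ⟩
        (p *R (q₁ , q₂)) +R r                 ≈⟨ Ring.+-cong (Ring.*-cong Ring.refl q≈h′+z) Ring.refl ⟩
        (p *R (h′ +R ⌜ z ⌝)) +R r             ≈⟨ Ring.+-cong (Ring.distribˡ p h′ ⌜ z ⌝) Ring.refl ⟩
        ((p *R h′) +R (p *R ⌜ z ⌝)) +R r      ≈⟨ Ring.+-assoc (p *R h′) (p *R ⌜ z ⌝) r ⟩
        (p *R h′) +R ((p *R ⌜ z ⌝) +R r)      ≈⟨ Ring.+-cong Ring.refl (Ring.+-cong (Ring.*-cong Ring.refl z≈m-n) Ring.refl) ⟩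
        (p *R h′) +R ((p *R (num m , num n)) +R r) ∎)
      A B : ℕ
      A = suc k ℕ.* m ℕ.+ r₁
      B = suc k ℕ.* n ℕ.+ r₂
      pz+r≈A-B : ((p *R (num m , num n)) +R r) ≈ (num A , num B)
      pz+r≈A-B = Ring.sym (ι-affine-pair (num (suc k)) (num A) (num B) (num m) (num n) (num r₁) (num r₂)
        (num-affine (suc k) m r₁) (num-affine (suc k) n r₂))
      A≡B : A ≡ B
      A≡B = num-difference∈H⇒≡ A B
        (resp (Ring.trans h-ph′≈pz+r pz+r≈A-B) (+-cl h∈H (neg-cl (⌜+n⌝*-closed (suc k) h′∈H))))
      h-ph′≈0 : ((a , b) -R (p *R h′)) ≈ 0R
      h-ph′≈0 = Ring.trans (Ring.trans h-ph′≈pz+r pz+r≈A-B)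
        (trans (+-zero (num A)) (trans (cong num A≡B) (sym (Semiring.+-identityˡ (num B)))))

    congruent-to-standard : ∀ m → Σ ℤ λ z → ∀ p .{{_ : NonZero p}} → ⌜ + p ⌝ ∣R (ι m -R ⌜ z ⌝)
    congruent-to-standard m with span (ι m)
    ... | h , z , h∈H , m≈h+z = z , λ p → let h′ , h≈ph′ = H-divisible p h∈H in
      h′ , Ring.trans (x≈y+z⇒x-y≈z (Ring.trans m≈h+z (Ring.+-comm h ⌜ z ⌝))) h≈ph′

mainTheorem5 : (M : ModelIE₂) → let open RingOf M in
    Nonstandard →
    (H : R → Set) → IsSubgroup H → IsDirectSumWithℤ H →
    (m : Carrier) → Σ ℤ λ z → (p : ℕ) → Prime p →
    ⌜ + p ⌝ ∣R (ι m -R ⌜ z ⌝)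
mainTheorem5 M _ H H-subgroup H⊕ℤ m =
  let z , z-works = congruent-to-standard M H H-subgroup H⊕ℤ m in
  z , λ p p-prime → z-works p {{prime⇒nonZero p-prime}}
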